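{- Let $p$ be a prime and $k$ a positive integer. Call $g$ in a group an involution if $g^2=1$ (the identity counts). \begin{enumerate} \item If $p>2$, there are exactly two conjugacy classes of involutions in $\operatorname{Hol}(\mathbb{Z}/p^k\mathbb{Z})$, with representatives $\lambda(1,0)$ and $\lambda(-1,0)$. \item There are exactly two conjugacy classes of involutions in $\operatorname{Hol}(\mathbb{Z}/2\mathbb{Z})$, with representatives $\lambda(1,0)$ and $\lambda(1,1)$. \item There are exactly four conjugacy classes of involutions in $\operatorname{Hol}(\mathbb{Z}/4\mathbb{Z})$, with representatives $\lambda(1,0),\lambda(1,2),\lambda(-1,0),\lambda(-1,1)$. \item For $k\geq3$, there are exactly six conjugacy classes of involutions in $\operatorname{Hol}(\mathbb{Z}/2^k\mathbb{Z})$, with representatives $\lambda(1,0)$, $\lambda(1,2^{k-1})$, $\lambda(-1,0)$, $\lambda(-1,1)$, $\lambda(2^{k-1}-1,0)$, $\lambda(2^{k-1}+1,0)$. \end{enumerate} In particular, for every positive integer $m$, the number of conjugacy classes of involutions in $\operatorname{Hol}(\mathbb{Z}/m\mathbb{Z})$ equals $c(\nu_2(m))\cdot2^{|\{p>2\text{ prime}:p\mid m\}|}$, where $c(0)=1$ and $c(\nu)=\min(6,2\nu)$ for $\nu\geq1$.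
   Context: For a positive integer $m$, $\operatorname{Hol}(\mathbb{Z}/m\mathbb{Z})$ is the group of permutations $\lambda(a,b):x\mapsto ax+b$ of $\mathbb{Z}/m\mathbb{Z}$ with $a$ a unit modulo $m$ and $b\in\mathbb{Z}/m\mathbb{Z}$, under composition. $\nu_2(m)$ is the $2$-adic valuation of $m$. -}

module Defs where

open import Data.Nat using (ℕ; zero; suc; _+_; _*_; _∸_; _^_; _<_; _≤?_; _<?_)
open import Data.Nat.Properties using (_≟_)
open import Data.Nat.Coprimality using (Coprime)
open import Data.Nat.Divisibility using (_∣_; _∣?_)
open import Data.Nat.Primality using (Prime; prime?)
open import Data.Product using (_×_; _,_; ∃₂; Σ)
open import Data.List using (List; length; filter; upTo)
open import Data.List.Relation.Unary.All using (All)
open import Data.List.Relation.Unary.Any using (Any)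
open import Data.List.Relation.Unary.AllPairs using (AllPairs)
open import Relation.Nullary using (¬_)
open import Relation.Nullary.Decidable using (_×-dec_)
open import Relation.Binary.PropositionalEquality using (_≡_)

_≡_[mod_] : ℕ → ℕ → ℕ → Set
x ≡ y [mod m ] = ∃₂ λ i j → x + i * m ≡ y + j * m

-- A pair (a , b) stands for the affine map λ(a,b) : x ↦ a x + b.
Aff : Set
Aff = ℕ × ℕ

-- (a , b) is (the canonical representative of) an element of Hol(ℤ/mℤ):
-- a, b are residues mod m and a is a unit mod m.
InHol : ℕ → Aff → Set
InHol m (a , b) = a < m × b < m × Coprime a m

_≈_[in_] : Aff → Aff → ℕ → Set
(a , b) ≈ (c , d) [in m ] = (a ≡ c [mod m ]) × (b ≡ d [mod m ])

_∘ₐ_ : Aff → Aff → Aff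
(a , b) ∘ₐ (c , d) = (a * c , a * d + b)

idₐ : Aff
idₐ = (1 , 0)

Involution : ℕ → Aff → Set
Involution m g = (g ∘ₐ g) ≈ idₐ [in m ]

Conj : ℕ → Aff → Aff → Set
Conj m g h = Σ Aff λ u → Σ Aff λ v →
  InHol m u × InHol m v × ((u ∘ₐ v) ≈ idₐ [in m ]) × (((u ∘ₐ g) ∘ₐ v) ≈ h [in m ])

ClassReps : ℕ → List Aff → Set
ClassReps m reps =
  All (InHol m) reps × All (Involution m) reps ×
  AllPairs (λ g h → ¬ Conj m g h) reps ×
  (∀ g → InHol m g → Involution m g → Any (Conj m g) reps)

NumInvClasses : ℕ → ℕ → Set
NumInvClasses m N = Σ (List Aff) λ reps → length reps ≡ N × ClassReps m reps

oddPrimeDivisorCount : ℕ → ℕ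
oddPrimeDivisorCount m =
  length (filter (λ p → (2 <? p) ×-dec (prime? p ×-dec (p ∣? m))) (upTo (suc m)))

c : ℕ → ℕ
c 0 = 1
c 1 = 2
c 2 = 4
c (suc (suc (suc _))) = 6

module Submission where

-- Conjugating λ(a, b) by λ(u, w) gives λ(a, u b + (1 − a) w). So the linear part a of an
-- involution is a conjugacy invariant with a² ≡ 1, and for fixed a the translation part b
-- matters only up to units and multiples of 1 − a. Modulo an odd prime power a = ±1, and the
-- classes are those of λ(1, 0) and λ(−1, 0) (2 is invertible). Modulo 2ᵏ, k ≥ 3, the square
-- roots of 1 are ±1 and 2ᵏ⁻¹ ± 1, and one checks by hand which translation parts survive.
-- By the Chinese remainder theorem, for coprime q and r an involution modulo q r is a pair of
-- involutions modulo q and modulo r, conjugate iff both components are; so the number of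
-- classes is multiplicative, and splitting off one odd prime power at a time gives the count.

open import Defs
open import Data.Nat
open import Data.Nat.Properties
open import Data.Nat.Divisibility
open import Data.Nat.DivMod
open import Data.Nat.Coprimality using (Coprime; coprime-Bézout; coprime-divisor)
import Data.Nat.Coprimality as Coprimality
open import Data.Nat.GCD using (module Bézout)
open import Data.Nat.Primality
open import Data.Nat.Primality.Factorisation using (factorise)
open import Data.Nat.Induction using (<-rec)
open import Data.Nat.Tactic.RingSolver using (solve-∀)
open import Data.Product using (∃; ∃₂; _×_; _,_; proj₁; proj₂)
open import Data.List using (List; []; _∷_; _++_; map; length; filter; upTo; cartesianProductWith)
open import Data.Nat.ListAction using (product)
open import Data.List.Properties using (length-++; length-map; filter-++; upTo-∷ʳ)
open import Data.Bool using (true; false; if_then_else_)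
open import Data.List.Relation.Unary.All using ([]; _∷_)
import Data.List.Relation.Unary.All as All
import Data.List.Relation.Unary.All.Properties as All
open import Data.List.Relation.Unary.Any using (Any; here; there)
import Data.List.Relation.Unary.Any.Properties as Any
open import Data.List.Relation.Unary.AllPairs using (AllPairs; []; _∷_)
import Data.List.Relation.Unary.AllPairs as AllPairs
import Data.List.Relation.Unary.AllPairs.Properties as AllPairs
open import Data.Sum using (_⊎_; inj₁; inj₂; [_,_]′)
open import Function using (_∘_)
open import Data.Empty using (⊥-elim)
open import Relation.Nullary using (¬_; Dec; yes; no; does)
open import Relation.Nullary.Decidable using (dec-true; dec-false; does-⇔; _×-dec_)
open import Function.Bundles using (_⇔_; mk⇔)
open import Relation.Binary.Bundles using (Setoid)
open import Relation.Binary.Structures using (IsEquivalence)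
open import Relation.Binary.PropositionalEquality
import Relation.Binary.Reasoning.Setoid as SetoidReasoning

-- Congruences

≡-mod-refl : ∀ {m x} → x ≡ x [mod m ]
≡-mod-refl = 0 , 0 , refl

≡⇒≡-mod : ∀ {m x y} → x ≡ y → x ≡ y [mod m ]
≡⇒≡-mod refl = ≡-mod-refl

≡-mod-sym : ∀ {m x y} → x ≡ y [mod m ] → y ≡ x [mod m ]
≡-mod-sym (i , j , e) = j , i , sym e

≡-mod-trans : ∀ {m x y z} → x ≡ y [mod m ] → y ≡ z [mod m ] → x ≡ z [mod m ]
≡-mod-trans {m} {x} {y} {z} (i , j , e) (k , l , f) = i + k , l + j , (begin
  x + (i + k) * m     ≡⟨ lemma x i k m ⟩
  (x + i * m) + k * m ≡⟨ cong (_+ k * m) e ⟩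
  (y + j * m) + k * m ≡⟨ lemma′ y j k m ⟩
  (y + k * m) + j * m ≡⟨ cong (_+ j * m) f ⟩
  (z + l * m) + j * m ≡⟨ lemma z l j m ⟨
  z + (l + j) * m     ∎)
  where
  open ≡-Reasoning
  lemma : ∀ x i k m → x + (i + k) * m ≡ (x + i * m) + k * m
  lemma = solve-∀
  lemma′ : ∀ y j k m → (y + j * m) + k * m ≡ (y + k * m) + j * m
  lemma′ = solve-∀

≡-mod-isEquivalence : ∀ m → IsEquivalence (_≡_[mod m ])
≡-mod-isEquivalence m = record { refl = ≡-mod-refl ; sym = ≡-mod-sym ; trans = ≡-mod-trans }

≡-mod-setoid : ℕ → Setoid _ _
≡-mod-setoid m = record { isEquivalence = ≡-mod-isEquivalence m }

module ≡-mod-Reasoning (m : ℕ) = SetoidReasoning (≡-mod-setoid m)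

+-cong-mod : ∀ {m x y u v} → x ≡ y [mod m ] → u ≡ v [mod m ] → (x + u) ≡ (y + v) [mod m ]
+-cong-mod {m} {x} {y} {u} {v} (i , j , e) (k , l , f) = i + k , j + l , (begin
  x + u + (i + k) * m         ≡⟨ lemma x u i k m ⟩
  (x + i * m) + (u + k * m)   ≡⟨ cong₂ _+_ e f ⟩
  (y + j * m) + (v + l * m)   ≡⟨ lemma y v j l m ⟨
  y + v + (j + l) * m         ∎)
  where
  open ≡-Reasoning
  lemma : ∀ x u i k m → x + u + (i + k) * m ≡ (x + i * m) + (u + k * m)
  lemma = solve-∀

*-cong-mod : ∀ {m x y u v} → x ≡ y [mod m ] → u ≡ v [mod m ] → (x * u) ≡ (y * v) [mod m ]
*-cong-mod {m} {x} {y} {u} {v} (i , j , e) (k , l , f) =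
  x * k + i * u + i * k * m , y * l + j * v + j * l * m , (begin
  x * u + (x * k + i * u + i * k * m) * m ≡⟨ lemma x u i k m ⟩
  (x + i * m) * (u + k * m)               ≡⟨ cong₂ _*_ e f ⟩
  (y + j * m) * (v + l * m)               ≡⟨ lemma y v j l m ⟨
  y * v + (y * l + j * v + j * l * m) * m ∎)
  where
  open ≡-Reasoning
  lemma : ∀ x u i k m → x * u + (x * k + i * u + i * k * m) * m ≡ (x + i * m) * (u + k * m)
  lemma = solve-∀

+-congˡ-mod : ∀ {m x y} z → x ≡ y [mod m ] → (z + x) ≡ (z + y) [mod m ]
+-congˡ-mod z = +-cong-mod (≡-mod-refl {x = z})

+-congʳ-mod : ∀ {m x y} z → x ≡ y [mod m ] → (x + z) ≡ (y + z) [mod m ]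
+-congʳ-mod z e = +-cong-mod e (≡-mod-refl {x = z})

*-congˡ-mod : ∀ {m x y} z → x ≡ y [mod m ] → (z * x) ≡ (z * y) [mod m ]
*-congˡ-mod z = *-cong-mod (≡-mod-refl {x = z})

*-congʳ-mod : ∀ {m x y} z → x ≡ y [mod m ] → (x * z) ≡ (y * z) [mod m ]
*-congʳ-mod z e = *-cong-mod e (≡-mod-refl {x = z})

+-cancelʳ-mod : ∀ {m x y} z → (x + z) ≡ (y + z) [mod m ] → x ≡ y [mod m ]
+-cancelʳ-mod {m} {x} {y} z (i , j , e) =
  i , j , +-cancelˡ-≡ z _ _ (trans (lemma z x i m) (trans e (sym (lemma z y j m))))
  where
  lemma : ∀ z x i m → z + (x + i * m) ≡ x + z + i * m
  lemma = solve-∀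

*-modulus≡0 : ∀ {m} k → (k * m) ≡ 0 [mod m ]
*-modulus≡0 k = 0 , k , +-identityʳ _

%-≡-mod : ∀ m .{{_ : NonZero m}} x → (x % m) ≡ x [mod m ]
%-≡-mod m x = x / m , 0 , (begin
  x % m + x / m * m ≡⟨ m≡m%n+[m/n]*n x m ⟨
  x                 ≡⟨ +-identityʳ x ⟨
  x + 0 * m         ∎)
  where open ≡-Reasoning

+-inverse-mod : ∀ m .{{_ : NonZero m}} x → (x + (m ∸ x % m) % m) ≡ 0 [mod m ]
+-inverse-mod m x = begin
  x + (m ∸ x % m) % m ≈⟨ +-cong-mod (%-≡-mod m x) (≡-mod-sym (%-≡-mod m (m ∸ x % m))) ⟨
  x % m + (m ∸ x % m) ≡⟨ m+[n∸m]≡n (<⇒≤ (m%n<n x m)) ⟩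
  m                   ≡⟨ *-identityˡ m ⟨
  1 * m               ≈⟨ *-modulus≡0 1 ⟩
  0                   ∎
  where open ≡-mod-Reasoning m

≡-mod⇒∣∣-∣ : ∀ {m x y} → x ≡ y [mod m ] → m ∣ ∣ x - y ∣
≡-mod⇒∣∣-∣ {m} {x} {y} (i , j , e) = divides ∣ j - i ∣ (begin
  ∣ x - y ∣                     ≡⟨ ∣m+n-m+o∣≡∣n-o∣ (i * m) x y ⟨
  ∣ i * m + x - i * m + y ∣     ≡⟨ cong₂ ∣_-_∣ (trans (+-comm (i * m) x) e) (+-comm (i * m) y) ⟩
  ∣ y + j * m - y + i * m ∣     ≡⟨ ∣m+n-m+o∣≡∣n-o∣ y (j * m) (i * m) ⟩
  ∣ j * m - i * m ∣             ≡⟨ *-distribʳ-∣-∣ m j i ⟨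
  ∣ j - i ∣ * m                 ∎)
  where open ≡-Reasoning

∣∣-∣⇒≡-mod : ∀ {m x y} → m ∣ ∣ x - y ∣ → x ≡ y [mod m ]
∣∣-∣⇒≡-mod {m} {x} {y} (divides q e) with ≤-total x y
... | inj₁ x≤y = q , 0 , (begin
  x + q * m       ≡⟨ cong (x +_) (trans (sym e) (m≤n⇒∣m-n∣≡n∸m x≤y)) ⟩
  x + (y ∸ x)     ≡⟨ m+[n∸m]≡n x≤y ⟩
  y               ≡⟨ +-identityʳ y ⟨
  y + 0 * m       ∎)
  where open ≡-Reasoning
... | inj₂ y≤x = 0 , q , (begin
  x + 0 * m       ≡⟨ +-identityʳ x ⟩
  x               ≡⟨ m+[n∸m]≡n y≤x ⟨
  y + (x ∸ y)     ≡⟨ cong (y +_) (trans (sym (m≤n⇒∣n-m∣≡n∸m y≤x)) e) ⟩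
  y + q * m       ∎)
  where open ≡-Reasoning

≡0-mod⇒∣ : ∀ {m x} → x ≡ 0 [mod m ] → m ∣ x
≡0-mod⇒∣ {x = x} e = subst (_ ∣_) (∣-∣-identityʳ x) (≡-mod⇒∣∣-∣ e)

∣⇒≡0-mod : ∀ {m x} → m ∣ x → x ≡ 0 [mod m ]
∣⇒≡0-mod {x = x} m∣x = ∣∣-∣⇒≡-mod (subst (_ ∣_) (sym (∣-∣-identityʳ x)) m∣x)

∣∧<⇒≡0 : ∀ {m t} → m ∣ t → t < m → t ≡ 0
∣∧<⇒≡0 {t = zero}  _   _   = refl
∣∧<⇒≡0 {t = suc t} m∣t t<m = ⊥-elim (<⇒≱ t<m (∣⇒≤ m∣t))

≡-mod∧<⇒≡ : ∀ {m x y} → x < m → y < m → x ≡ y [mod m ] → x ≡ y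
≡-mod∧<⇒≡ {x = x} {y} x<m y<m e =
  ∣m-n∣≡0⇒m≡n (∣∧<⇒≡0 (≡-mod⇒∣∣-∣ e) (≤-<-trans (∣m-n∣≤m⊔n x y) (⊔-lub x<m y<m)))

≡-mod-∣ : ∀ {d m x y} → d ∣ m → x ≡ y [mod m ] → x ≡ y [mod d ]
≡-mod-∣ d∣m e = ∣∣-∣⇒≡-mod (∣-trans d∣m (≡-mod⇒∣∣-∣ e))

coprime⇒*-∣ : ∀ {q r t} → Coprime q r → q ∣ t → r ∣ t → q * r ∣ t
coprime⇒*-∣ {q} {r} c (divides s refl) r∣sq =
  subst (_∣ s * q) (*-comm r q) (*-monoˡ-∣ q (coprime-divisor (Coprimality.sym c) (subst (r ∣_) (*-comm s q) r∣sq)))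

≡-mod-* : ∀ {q r x y} → Coprime q r → x ≡ y [mod q ] → x ≡ y [mod r ] → x ≡ y [mod (q * r) ]
≡-mod-* c e f = ∣∣-∣⇒≡-mod (coprime⇒*-∣ c (≡-mod⇒∣∣-∣ e) (≡-mod⇒∣∣-∣ f))

-- Units and prime divisors

coprime⇒invertible : ∀ {a m} → Coprime a m → ∃ λ x → (a * x) ≡ 1 [mod m ]
coprime⇒invertible {a} {m} c with coprime-Bézout c
... | Bézout.+- x y eq = x , 0 , y , trans (+-identityʳ _) (trans (*-comm a x) (sym eq))
coprime⇒invertible {a} {zero} c | Bézout.-+ x y eq = ⊥-elim (1+n≢0 (trans eq (*-zeroʳ y)))
coprime⇒invertible {a} {suc n} c | Bézout.-+ x y eq = x * n , 1 , y * n , (begin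
  a * (x * n) + 1 * suc n ≡⟨ lemma a x n ⟩
  suc ((1 + x * a) * n)   ≡⟨ cong (λ t → suc (t * n)) eq ⟩
  suc (y * suc n * n)     ≡⟨ lemma′ y n ⟩
  1 + y * n * suc n       ∎)
  where
  open ≡-Reasoning
  lemma : ∀ a x n → a * (x * n) + 1 * suc n ≡ suc ((1 + x * a) * n)
  lemma = solve-∀
  lemma′ : ∀ y n → suc (y * suc n * n) ≡ 1 + y * n * suc n
  lemma′ = solve-∀

invertible⇒coprime : ∀ {a m x} → (a * x) ≡ 1 [mod m ] → Coprime a m
invertible⇒coprime {a} {m} {x} (i , j , e) {d} (d∣a , d∣m) =
  ∣1⇒≡1 (∣m+n∣m⇒∣n (subst (d ∣_) (trans e (+-comm 1 (j * m)))
    (∣m∣n⇒∣m+n (∣m⇒∣m*n x d∣a) (∣n⇒∣m*n i d∣m))) (∣n⇒∣m*n j d∣m))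

coprime-resp-≡-mod : ∀ {a a′ m} → a ≡ a′ [mod m ] → Coprime a m → Coprime a′ m
coprime-resp-≡-mod {a′ = a′} e c with coprime⇒invertible c
... | x , ax≡1 = invertible⇒coprime {x = x} (≡-mod-trans (*-congʳ-mod x (≡-mod-sym e)) ax≡1)

coprime-∣ : ∀ {a d m} → d ∣ m → Coprime a m → Coprime a d
coprime-∣ d∣m c with coprime⇒invertible c
... | x , ax≡1 = invertible⇒coprime {x = x} (≡-mod-∣ d∣m ax≡1)

coprime-* : ∀ {a b m} → Coprime a m → Coprime b m → Coprime (a * b) m
coprime-* {a} {b} ca cb with coprime⇒invertible ca | coprime⇒invertible cb
... | x , ax≡1 | y , by≡1 = invertible⇒coprime {x = x * y}
  (≡-mod-trans (≡⇒≡-mod (lemma a b x y)) (*-cong-mod ax≡1 by≡1))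
  where
  lemma : ∀ a b x y → a * b * (x * y) ≡ a * x * (b * y)
  lemma = solve-∀

coprime-^ : ∀ {a m} → Coprime a m → ∀ j → Coprime (a ^ j) m
coprime-^ {m = m} _ zero    = Coprimality.1-coprimeTo m
coprime-^         c (suc j) = coprime-* c (coprime-^ c j)

prime∤⇒coprime : ∀ {p n} → Prime p → ¬ p ∣ n → Coprime p n
prime∤⇒coprime {n = n} pp p∤n (d∣p , d∣n) with prime⇒irreducible pp d∣p
... | inj₁ d≡1 = d≡1
... | inj₂ refl = ⊥-elim (p∤n d∣n)

prime^-∣-*⇒∣ : ∀ {p} → Prime p → ∀ k {x y} → p ^ k ∣ x * y → ¬ p ∣ y → p ^ k ∣ x
prime^-∣-*⇒∣ {p} pp k {x} {y} pᵏ∣xy p∤y =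
  coprime-divisor (coprime-^ (prime∤⇒coprime pp p∤y) k) (subst (p ^ k ∣_) (*-comm x y) pᵏ∣xy)

2∤1 : ¬ 2 ∣ 1
2∤1 2∣1 with ∣1⇒≡1 2∣1
... | ()

2∤odd-prime^ : ∀ {p} → Prime p → 2 < p → ∀ k → ¬ 2 ∣ p ^ k
2∤odd-prime^ {p} pp 2<p k 2∣pᵏ = 2≢1 (coprime-^ (prime∤⇒coprime pp p∤2) k (2∣pᵏ , ∣-refl))
  where
  p∤2 : ¬ p ∣ 2
  p∤2 p∣2 = <⇒≱ 2<p (∣⇒≤ p∣2)
  2≢1 : 2 ≢ 1
  2≢1 ()

prime∣prime^⇒≡ : ∀ {p q} → Prime p → Prime q → ∀ k → p ∣ q ^ k → p ≡ q
prime∣prime^⇒≡ pp pq zero p∣1 = ⊥-elim (nonTrivial⇒≢1 {{prime⇒nonTrivial pp}} (∣1⇒≡1 p∣1))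
prime∣prime^⇒≡ {p} {q} pp pq (suc k) p∣qᵏ⁺¹ with euclidsLemma q (q ^ k) pp p∣qᵏ⁺¹
... | inj₂ p∣qᵏ = prime∣prime^⇒≡ pp pq k p∣qᵏ
... | inj₁ p∣q with prime⇒irreducible pq p∣q
...   | inj₁ refl = ⊥-elim (nonTrivial⇒≢1 {{prime⇒nonTrivial pp}} refl)
...   | inj₂ p≡q  = p≡q

∃-prime-divisor : ∀ n → 1 < n → ∃ λ p → Prime p × p ∣ n
∃-prime-divisor n 1<n with factorise n {{>-nonZero (<-trans z<s 1<n)}}
... | record { factors = [] ; isFactorisation = n≡1 } = ⊥-elim (<⇒≢ 1<n (sym n≡1))
... | record { factors = p ∷ ps ; isFactorisation = n≡p*ps ; factorsPrime = pp ∷ _ } =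
  p , pp , divides (product ps) (trans n≡p*ps (*-comm p (product ps)))

prime^-split : ∀ {p} → Prime p → ∀ m → .{{_ : NonZero m}} → ∃₂ λ j r → m ≡ p ^ j * r × ¬ p ∣ r
prime^-split {p} pp = <-rec (λ m → .{{NonZero m}} → Split m) split
  where
  Split : ℕ → Set
  Split m = ∃₂ λ j r → m ≡ p ^ j * r × ¬ p ∣ r
  split : ∀ m → (∀ {s} → s < m → .{{NonZero s}} → Split s) → .{{NonZero m}} → Split m
  split m rec with p ∣? m
  ... | no p∤m = 0 , m , sym (*-identityˡ m) , p∤m
  ... | yes (divides s refl) with rec s<sp {{s≢0}}
    where
    s≢0 : NonZero s
    s≢0 = m*n≢0⇒m≢0 s
    s<sp : s < s * p
    s<sp = m<m*n s p {{s≢0}} (nonTrivial⇒n>1 p {{prime⇒nonTrivial pp}})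
  ...   | j , r , s≡pʲr , p∤r = suc j , r , trans (cong (_* p) s≡pʲr) (lemma (p ^ j) r p) , p∤r
    where
    lemma : ∀ x r p → x * r * p ≡ p * x * r
    lemma = solve-∀

¬2∣⇒odd : ∀ n → ¬ 2 ∣ n → n ≡ suc (2 * (n / 2))
¬2∣⇒odd n 2∤n = begin
  n                   ≡⟨ m≡m%n+[m/n]*n n 2 ⟩
  n % 2 + n / 2 * 2   ≡⟨ cong₂ _+_ n%2≡1 (*-comm (n / 2) 2) ⟩
  suc (2 * (n / 2))   ∎
  where
  open ≡-Reasoning
  n%2≡1 : n % 2 ≡ 1
  n%2≡1 with n % 2 | m%n<n n 2 | m%n≡0⇒n∣m n 2
  ... | 0 | _         | 2∣n = ⊥-elim (2∤n (2∣n refl))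
  ... | 1 | _         | _   = refl
  ... | suc (suc _) | s≤s (s≤s () ) | _

half-mod-odd : ∀ {m} → ¬ 2 ∣ m → ∀ b → ∃ λ d → (2 * d) ≡ b [mod m ]
half-mod-odd {m} 2∤m b = b * suc h , 0 , b , (begin
  2 * (b * suc h) + 0 * m ≡⟨ lemma b h ⟩
  b + b * suc (2 * h)     ≡⟨ cong (λ n → b + b * n) m≡1+2h ⟨
  b + b * m               ∎)
  where
  open ≡-Reasoning
  h : ℕ
  h = m / 2
  m≡1+2h : m ≡ suc (2 * h)
  m≡1+2h = ¬2∣⇒odd m 2∤m
  lemma : ∀ b h → 2 * (b * suc h) + 0 * m ≡ b + b * suc (2 * h)
  lemma = solve-∀

∣∧≤2*⇒ : ∀ {q x} .{{_ : NonZero q}} → q ∣ x → x ≤ 2 * q → x ≡ 0 ⊎ x ≡ q ⊎ x ≡ 2 * q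
∣∧≤2*⇒ {q} (divides j refl) jq≤2q with *-cancelʳ-≤ j 2 q jq≤2q
... | z≤n             = inj₁ refl
... | s≤s z≤n          = inj₂ (inj₁ (*-identityˡ q))
... | s≤s (s≤s z≤n)    = inj₂ (inj₂ refl)

∣∧<2*⇒ : ∀ {q x} .{{_ : NonZero q}} → q ∣ x → x < 2 * q → x ≡ 0 ⊎ x ≡ q
∣∧<2*⇒ q∣x x<2q with ∣∧≤2*⇒ q∣x (<⇒≤ x<2q)
... | inj₁ x≡0        = inj₁ x≡0
... | inj₂ (inj₁ x≡q) = inj₂ x≡q
... | inj₂ (inj₂ refl) = ⊥-elim (<-irrefl refl x<2q)

suc[m∸1]≡m : ∀ {m} .{{_ : NonZero m}} → suc (m ∸ 1) ≡ m
suc[m∸1]≡m {suc m} = refl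

m∸1<m : ∀ {m} .{{_ : NonZero m}} → m ∸ 1 < m
m∸1<m {suc m} = ≤-refl

n*n≡1-mod-1+n : ∀ n → (n * n) ≡ 1 [mod suc n ]
n*n≡1-mod-1+n n = 2 , suc n , lemma n
  where
  lemma : ∀ n → n * n + 2 * suc n ≡ 1 + suc n * suc n
  lemma = solve-∀

-- Square roots of unity

sqrt1⇒∣ : ∀ {m a} → (suc a * suc a) ≡ 1 [mod m ] → m ∣ a * suc (suc a)
sqrt1⇒∣ {a = a} e = ≡0-mod⇒∣ (+-cancelʳ-mod 1 (≡-mod-trans (≡⇒≡-mod (lemma a)) e))
  where
  lemma : ∀ a → a * suc (suc a) + 1 ≡ suc a * suc a
  lemma = solve-∀

sqrt1-mod-odd-prime^ : ∀ {p} → Prime p → 2 < p → ∀ k {a} → a < p ^ k → (a * a) ≡ 1 [mod p ^ k ] →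
  a ≡ 1 ⊎ suc a ≡ p ^ k
sqrt1-mod-odd-prime^ pp 2<p k {zero} _ 0≡1 = inj₂ (sym (∣1⇒≡1 (≡0-mod⇒∣ (≡-mod-sym 0≡1))))
sqrt1-mod-odd-prime^ {p} pp 2<p k {suc a} 1+a<pᵏ e with p ∣? suc (suc a)
... | no  p∤2+a =
  inj₁ (cong suc (∣∧<⇒≡0 (prime^-∣-*⇒∣ pp k (sqrt1⇒∣ {a = a} e) p∤2+a) (<-trans (n<1+n a) 1+a<pᵏ)))
... | yes p∣2+a = inj₂ (≤-antisym 1+a<pᵏ (∣⇒≤ pᵏ∣2+a))
  where
  p∤a : ¬ p ∣ a
  p∤a p∣a = <⇒≱ 2<p (∣⇒≤ (∣m+n∣m⇒∣n (subst (p ∣_) (+-comm 2 a) p∣2+a) p∣a))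
  pᵏ∣2+a : p ^ k ∣ suc (suc a)
  pᵏ∣2+a = prime^-∣-*⇒∣ pp k (subst (p ^ k ∣_) (*-comm a (suc (suc a))) (sqrt1⇒∣ {a = a} e)) p∤a

2∣∧sqrt1⇒odd : ∀ {m a} → 2 ∣ m → (a * a) ≡ 1 [mod m ] → ¬ 2 ∣ a
2∣∧sqrt1⇒odd {a = a} 2∣m e 2∣a =
  2∤1 (≡0-mod⇒∣ (≡-mod-trans (≡-mod-sym (≡-mod-∣ 2∣m e)) (∣⇒≡0-mod (∣m⇒∣m*n a 2∣a))))

Sqrt1-mod-2^ : ℕ → ℕ → Set
Sqrt1-mod-2^ n a = a ≡ 1 ⊎ a ≡ 2 ^ (1 + n) + 1 ⊎ suc a ≡ 2 ^ (1 + n) ⊎ suc a ≡ 2 ^ (2 + n)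

-- An odd a = 1 + 2s squares to 1 + 4 s (1 + s), and one of s, 1 + s is odd.
odd-sqrt1-mod-2^ : ∀ n s → suc (2 * s) < 2 ^ (2 + n) →
  (suc (2 * s) * suc (2 * s)) ≡ 1 [mod 2 ^ (2 + n) ] → Sqrt1-mod-2^ n (suc (2 * s))
odd-sqrt1-mod-2^ n s a<M e = by-parity (2 ∣? s)
  where
  instance _ = m^n≢0 2 n
  lemma : ∀ s → 2 * s * suc (suc (2 * s)) ≡ 2 * (2 * (s * suc s))
  lemma = solve-∀
  double-suc : ∀ s → suc (suc (2 * s)) ≡ 2 * suc s
  double-suc = solve-∀
  2ⁿ∣s[1+s] : 2 ^ n ∣ s * suc s
  2ⁿ∣s[1+s] = *-cancelˡ-∣ 2 (*-cancelˡ-∣ 2 (subst (2 ^ (2 + n) ∣_) (lemma s) (sqrt1⇒∣ {a = 2 * s} e)))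
  s<2ⁿ⁺¹ : s < 2 * 2 ^ n
  s<2ⁿ⁺¹ = *-cancelˡ-< 2 s (2 * 2 ^ n) (<-trans (n<1+n (2 * s)) a<M)
  1+s≤2ⁿ⁺¹ : suc s ≤ 2 * 2 ^ n
  1+s≤2ⁿ⁺¹ = *-cancelˡ-≤ 2 (subst (_≤ 2 ^ (2 + n)) (double-suc s) a<M)
  by-parity : Dec (2 ∣ s) → Sqrt1-mod-2^ n (suc (2 * s))
  by-parity (yes 2∣s) =
    [ (λ s≡0 → inj₁ (cong (λ t → suc (2 * t)) s≡0))
    , (λ s≡2ⁿ → inj₂ (inj₁ (trans (cong (λ t → suc (2 * t)) s≡2ⁿ) (+-comm 1 (2 ^ (1 + n))))))
    ]′ (∣∧<2*⇒ (prime^-∣-*⇒∣ prime[2] n 2ⁿ∣s[1+s] 2∤1+s) s<2ⁿ⁺¹)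
    where
    2∤1+s : ¬ 2 ∣ suc s
    2∤1+s 2∣1+s = 2∤1 (∣m+n∣m⇒∣n (subst (2 ∣_) (+-comm 1 s) 2∣1+s) 2∣s)
  by-parity (no 2∤s) =
    [ (λ ())
    , [ (λ 1+s≡2ⁿ → inj₂ (inj₂ (inj₁ (trans (double-suc s) (cong (2 *_) 1+s≡2ⁿ)))))
      , (λ 1+s≡2ⁿ⁺¹ → inj₂ (inj₂ (inj₂ (trans (double-suc s) (cong (2 *_) 1+s≡2ⁿ⁺¹)))))
      ]′
    ]′ (∣∧≤2*⇒ (prime^-∣-*⇒∣ prime[2] n (subst (2 ^ n ∣_) (*-comm s (suc s)) 2ⁿ∣s[1+s]) 2∤s)
               1+s≤2ⁿ⁺¹)

sqrt1-mod-2^ : ∀ n {a} → a < 2 ^ (2 + n) → (a * a) ≡ 1 [mod 2 ^ (2 + n) ] → Sqrt1-mod-2^ n a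
sqrt1-mod-2^ n {a} a<M e = subst (Sqrt1-mod-2^ n) (sym a≡1+2s)
  (odd-sqrt1-mod-2^ n (a / 2) (subst (_< 2 ^ (2 + n)) a≡1+2s a<M)
                              (subst (λ x → (x * x) ≡ 1 [mod 2 ^ (2 + n) ]) a≡1+2s e))
  where
  a≡1+2s : a ≡ suc (2 * (a / 2))
  a≡1+2s = ¬2∣⇒odd a (2∣∧sqrt1⇒odd (∣n⇒∣m*n 2 (m∣m*n (2 ^ n))) e)

-- Conjugation in the holomorph

≈ₐ-refl : ∀ {m g} → g ≈ g [in m ]
≈ₐ-refl = ≡-mod-refl , ≡-mod-refl

≈ₐ-sym : ∀ {m g h} → g ≈ h [in m ] → h ≈ g [in m ]
≈ₐ-sym (e , f) = ≡-mod-sym e , ≡-mod-sym f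

≈ₐ-trans : ∀ {m g h k} → g ≈ h [in m ] → h ≈ k [in m ] → g ≈ k [in m ]
≈ₐ-trans (e , f) (e′ , f′) = ≡-mod-trans e e′ , ≡-mod-trans f f′

∘ₐ-cong : ∀ {m g g′ h h′} → g ≈ g′ [in m ] → h ≈ h′ [in m ] →
  (g ∘ₐ h) ≈ (g′ ∘ₐ h′) [in m ]
∘ₐ-cong {g = _ , _} {_ , _} {_ , _} {_ , _} (e₁ , e₂) (e₃ , e₄) =
  *-cong-mod e₁ e₃ , +-cong-mod (*-cong-mod e₁ e₄) e₂

∘ₐ-identityʳ : ∀ {m} g → (g ∘ₐ idₐ) ≈ g [in m ]
∘ₐ-identityʳ (a , b) = ≡⇒≡-mod (*-identityʳ a) , ≡⇒≡-mod (cong (_+ b) (*-zeroʳ a))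

≈ₐ-∣ : ∀ {d m g h} → d ∣ m → g ≈ h [in m ] → g ≈ h [in d ]
≈ₐ-∣ d∣m (e , f) = ≡-mod-∣ d∣m e , ≡-mod-∣ d∣m f

idₐ-inHol : ∀ {m} → 1 < m → InHol m idₐ
idₐ-inHol 1<m = 1<m , <-trans z<s 1<m , Coprimality.1-coprimeTo _

idₐ-involution : ∀ {m} → Involution m idₐ
idₐ-involution = ≈ₐ-refl

linear-inHol : ∀ {m a} → a < m → (a * a) ≡ 1 [mod m ] → InHol m (a , 0)
linear-inHol a<m a²≡1 = a<m , ≤-<-trans z≤n a<m , invertible⇒coprime a²≡1

linear-involution : ∀ {m} a → (a * a) ≡ 1 [mod m ] → Involution m (a , 0)
linear-involution a a²≡1 = a²≡1 , ≡⇒≡-mod (cong (_+ 0) (*-zeroʳ a))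

reflection-inHol : ∀ {m a b} → suc a ≡ m → b < m → InHol m (a , b)
reflection-inHol {a = a} refl b<m = ≤-refl , b<m , invertible⇒coprime (n*n≡1-mod-1+n a)

reflection-involution : ∀ {m a} → suc a ≡ m → ∀ b → Involution m (a , b)
reflection-involution {a = a} refl b = n*n≡1-mod-1+n a , 0 , b , lemma a b
  where
  lemma : ∀ a b → a * b + b + 0 * suc a ≡ 0 + b * suc a
  lemma = solve-∀

conj-idₐ : ∀ {m h} → Conj m idₐ h → h ≈ idₐ [in m ]
conj-idₐ (u , v , _ , _ , uv≈id , uidv≈h) =
  ≈ₐ-trans (≈ₐ-sym uidv≈h) (≈ₐ-trans (∘ₐ-cong (∘ₐ-identityʳ u) ≈ₐ-refl) uv≈id)

¬conj-idₐ : ∀ {m a b} → 0 < b → b < m → ¬ Conj m idₐ (a , b)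
¬conj-idₐ 0<b b<m c = <⇒≢ 0<b (sym (≡-mod∧<⇒≡ b<m (<-trans 0<b b<m) (proj₂ (conj-idₐ c))))

conj-linear-part : ∀ {m a b a′ b′} → Conj m (a , b) (a′ , b′) → a′ ≡ a [mod m ]
conj-linear-part {m} {a} {_} {a′} ((x , _) , (y , _) , _ , _ , (xy≡1 , _) , (xay≡a′ , _)) = begin
  a′        ≈⟨ xay≡a′ ⟨
  x * a * y ≡⟨ lemma x a y ⟩
  a * (x * y) ≈⟨ *-congˡ-mod a xy≡1 ⟩
  a * 1     ≡⟨ *-identityʳ a ⟩
  a         ∎
  where
  open ≡-mod-Reasoning m
  lemma : ∀ x a y → x * a * y ≡ a * (x * y)
  lemma = solve-∀

¬conj-linear-part : ∀ {m a b a′ b′} → a < m → a′ < m → a ≢ a′ → ¬ Conj m (a , b) (a′ , b′)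
¬conj-linear-part a<m a′<m a≢a′ c = a≢a′ (≡-mod∧<⇒≡ a<m a′<m (≡-mod-sym (conj-linear-part c)))

-- For u = λ(x, w) and u⁻¹ = λ(y, d) one has x d + w ≡ 0, so e = x d works.
conj-translation-part : ∀ {m a b a′ b′} → Conj m (a , b) (a′ , b′) →
  ∃₂ λ x e → (b′ + e) ≡ (x * b + a * e) [mod m ]
conj-translation-part {m} {a} {b} {a′} {b′} ((x , w) , (y , d) , _ , _ , (_ , xd+w≡0) , (_ , e≡b′)) =
  x , x * d , (begin
  b′ + x * d                          ≈⟨ +-congʳ-mod (x * d) e≡b′ ⟨
  x * a * d + (x * b + w) + x * d     ≡⟨ lemma x a d b w ⟩
  (x * b + a * (x * d)) + (x * d + w) ≈⟨ +-congˡ-mod (x * b + a * (x * d)) xd+w≡0 ⟩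
  (x * b + a * (x * d)) + 0           ≡⟨ +-identityʳ _ ⟩
  x * b + a * (x * d)                 ∎)
  where
  open ≡-mod-Reasoning m
  lemma : ∀ x a d b w → x * a * d + (x * b + w) + x * d ≡ (x * b + a * (x * d)) + (x * d + w)
  lemma = solve-∀

-- Conjugation by the translation x ↦ x − d; the congruence says b′ = b + (a − 1) d.
conj-by-translation : ∀ {m} → 1 < m → ∀ {a b b′} d → (b′ + d) ≡ (b + a * d) [mod m ] →
  Conj m (a , b) (a , b′)
conj-by-translation {m} 1<m {a} {b} {b′} d e =
  (1 , w) , (1 , d % m) ,
  (1<m , m%n<n _ m , Coprimality.1-coprimeTo m) , (1<m , m%n<n d m , Coprimality.1-coprimeTo m) ,
  uv≈id , ugv≈g′
  where
  instance _ = >-nonZero (<-trans z<s 1<m)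
  w : ℕ
  w = (m ∸ d % m) % m
  d+w≡0 : (d + w) ≡ 0 [mod m ]
  d+w≡0 = +-inverse-mod m d
  1*d≡d : (1 * (d % m)) ≡ d [mod m ]
  1*d≡d = ≡-mod-trans (≡⇒≡-mod (*-identityˡ _)) (%-≡-mod m d)
  uv≈id : ((1 , w) ∘ₐ (1 , d % m)) ≈ idₐ [in m ]
  uv≈id = ≡-mod-refl , ≡-mod-trans (+-congʳ-mod w 1*d≡d) d+w≡0
  ugv≈g′ : (((1 , w) ∘ₐ (a , b)) ∘ₐ (1 , d % m)) ≈ (a , b′) [in m ]
  ugv≈g′ = ≡⇒≡-mod (trans (*-identityʳ (1 * a)) (*-identityˡ a)) , (begin
    1 * a * (d % m) + (1 * b + w) ≈⟨ +-congʳ-mod (1 * b + w) (*-congˡ-mod (1 * a) (%-≡-mod m d)) ⟩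
    1 * a * d + (1 * b + w)       ≡⟨ lemma a b d w ⟩
    (b + a * d) + w               ≈⟨ +-congʳ-mod w e ⟨
    (b′ + d) + w                  ≡⟨ +-assoc b′ d w ⟩
    b′ + (d + w)                  ≈⟨ +-congˡ-mod b′ d+w≡0 ⟩
    b′ + 0                        ≡⟨ +-identityʳ b′ ⟩
    b′                            ∎)
    where
    open ≡-mod-Reasoning m
    lemma : ∀ a b d w → 1 * a * d + (1 * b + w) ≡ (b + a * d) + w
    lemma = solve-∀

conj-refl : ∀ {m} → 1 < m → ∀ g → Conj m g g
conj-refl 1<m (a , b) = conj-by-translation 1<m 0 (≡⇒≡-mod (cong (b +_) (sym (*-zeroʳ a))))

conj-reflection : ∀ {m} → 1 < m → ∀ {a b b′} → suc a ≡ m → ∀ d → (b′ + 2 * d) ≡ b [mod m ] →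
  Conj m (a , b) (a , b′)
conj-reflection {m} 1<m {a} {b} {b′} 1+a≡m d e = conj-by-translation 1<m d (+-cancelʳ-mod d (begin
  b′ + d + d          ≡⟨ lemma b′ d ⟩
  b′ + 2 * d          ≈⟨ e ⟩
  b                   ≡⟨ +-identityʳ b ⟨
  b + 0               ≈⟨ +-congˡ-mod b (*-modulus≡0 d) ⟨
  b + d * m           ≡⟨ cong (λ n → b + d * n) 1+a≡m ⟨
  b + d * suc a       ≡⟨ lemma′ b a d ⟩
  b + a * d + d       ∎))
  where
  open ≡-mod-Reasoning m
  lemma : ∀ b′ d → b′ + d + d ≡ b′ + 2 * d
  lemma = solve-∀
  lemma′ : ∀ b a d → b + d * suc a ≡ b + a * d + d
  lemma′ = solve-∀

conj-reflection-parity : ∀ {m a a′ b′} → 2 ∣ m → 2 ∣ suc a → Conj m (a , 0) (a′ , b′) → 2 ∣ b′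
conj-reflection-parity {m} {a} {a′} {b′} 2∣m 2∣1+a c = by-translation-part (conj-translation-part c)
  where
  by-translation-part : (∃₂ λ x e → (b′ + e) ≡ (x * 0 + a * e) [mod m ]) → 2 ∣ b′
  by-translation-part (x , e , eq) = ≡0-mod⇒∣ (+-cancelʳ-mod (e + e) (begin
    b′ + (e + e)        ≡⟨ +-assoc b′ e e ⟨
    b′ + e + e          ≈⟨ +-congʳ-mod e (≡-mod-∣ 2∣m eq) ⟩
    x * 0 + a * e + e   ≡⟨ lemma x a e ⟩
    suc a * e           ≈⟨ ∣⇒≡0-mod (∣m⇒∣m*n e 2∣1+a) ⟩
    0                   ≈⟨ ∣⇒≡0-mod (divides e (lemma′ e)) ⟨
    0 + (e + e)         ∎))
    where
    open ≡-mod-Reasoning 2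
    lemma : ∀ x a e → x * 0 + a * e + e ≡ suc a * e
    lemma = solve-∀
    lemma′ : ∀ e → 0 + (e + e) ≡ e * 2
    lemma′ = solve-∀

-- Involution classes modulo prime powers

odd-prime^-classes : ∀ p k → Prime p → 2 < p → 1 ≤ k →
  ClassReps (p ^ k) ((1 , 0) ∷ (p ^ k ∸ 1 , 0) ∷ [])
odd-prime^-classes p k pp 2<p 1≤k =
  (idₐ-inHol 1<M ∷ reflection-inHol suc[m∸1]≡m 0<M ∷ []) ,
  (idₐ-involution ∷ reflection-involution suc[m∸1]≡m 0 ∷ []) ,
  ((¬conj-linear-part 1<M m∸1<m 1≢M∸1 ∷ []) ∷ [] ∷ []) ,
  cover
  where
  M : ℕ
  M = p ^ k
  instance _ = m^n≢0 p k {{prime⇒nonZero pp}}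
  2<M : 2 < M
  2<M = <-≤-trans 2<p (subst (_≤ M) (*-identityʳ p) (^-monoʳ-≤ p {{prime⇒nonZero pp}} 1≤k))
  0<M : 0 < M
  0<M = <-trans z<s (<-trans (n<1+n 1) 2<M)
  1<M : 1 < M
  1<M = <-trans (n<1+n 1) 2<M
  1≢M∸1 : 1 ≢ M ∸ 1
  1≢M∸1 1≡M∸1 = <-irrefl (trans (cong suc 1≡M∸1) suc[m∸1]≡m) 2<M
  p∤2 : ¬ p ∣ 2
  p∤2 p∣2 = <⇒≱ 2<p (∣⇒≤ p∣2)
  2∤M : ¬ 2 ∣ M
  2∤M = 2∤odd-prime^ pp 2<p k
  cover : ∀ g → InHol M g → Involution M g → Any (Conj M g) ((1 , 0) ∷ (M ∸ 1 , 0) ∷ [])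
  cover (a , b) (a<M , b<M , _) (a²≡1 , ab+b≡0) with sqrt1-mod-odd-prime^ pp 2<p k a<M a²≡1
  ... | inj₁ refl = here (subst (λ x → Conj M (1 , x) (1 , 0)) (sym b≡0) (conj-refl 1<M _))
    where
    b≡0 : b ≡ 0
    b≡0 = ∣∧<⇒≡0 (prime^-∣-*⇒∣ pp k (subst (M ∣_) (lemma b) (≡0-mod⇒∣ ab+b≡0)) p∤2) b<M
      where
      lemma : ∀ b → 1 * b + b ≡ b * 2
      lemma = solve-∀
  ... | inj₂ 1+a≡M = there (here (subst (λ x → Conj M (a , b) (x , 0)) a≡M∸1
                                    (conj-reflection 1<M 1+a≡M d 2d≡b)))
    where
    a≡M∸1 : a ≡ M ∸ 1
    a≡M∸1 = cong (_∸ 1) 1+a≡M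
    d : ℕ
    d = proj₁ (half-mod-odd 2∤M b)
    2d≡b : (2 * d) ≡ b [mod M ]
    2d≡b = proj₂ (half-mod-odd 2∤M b)

classes-mod-1 : ClassReps 1 ((0 , 0) ∷ [])
classes-mod-1 = (0∈Hol ∷ []) , ((≡-mod-1 , ≡-mod-1) ∷ []) , ([] ∷ []) ,
  λ _ _ _ → here ((0 , 0) , (0 , 0) , 0∈Hol , 0∈Hol , (≡-mod-1 , ≡-mod-1) , (≡-mod-1 , ≡-mod-1))
  where
  ≡-mod-1 : ∀ {x y} → x ≡ y [mod 1 ]
  ≡-mod-1 {x} {y} = y , x , lemma x y
    where
    lemma : ∀ x y → x + y * 1 ≡ y + x * 1
    lemma = solve-∀
  0∈Hol : InHol 1 (0 , 0)
  0∈Hol = z<s , z<s , Coprimality.sym (Coprimality.1-coprimeTo 0)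

classes-mod-2 : ClassReps 2 ((1 , 0) ∷ (1 , 1) ∷ [])
classes-mod-2 =
  (idₐ-inHol ≤-refl ∷ reflection-inHol refl ≤-refl ∷ []) ,
  (idₐ-involution ∷ reflection-involution refl 1 ∷ []) ,
  ((¬conj-idₐ z<s ≤-refl ∷ []) ∷ [] ∷ []) ,
  cover
  where
  cover : ∀ g → InHol 2 g → Involution 2 g → Any (Conj 2 g) ((1 , 0) ∷ (1 , 1) ∷ [])
  cover (0 , _) (_ , _ , c) _ with c {2} (divides 0 refl , ∣-refl)
  ... | ()
  cover (1 , 0) _ _ = here (conj-refl ≤-refl _)
  cover (1 , 1) _ _ = there (here (conj-refl ≤-refl _))
  cover (1 , suc (suc _)) (_ , s≤s (s≤s ()) , _) _
  cover (suc (suc _) , _) (s≤s (s≤s ()) , _) _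

module EvenModulus (H : ℕ) .{{_ : NonZero H}} where

  M : ℕ
  M = 2 * H

  instance
    M≢0 : NonZero M
    M≢0 = m*n≢0 2 H

  H<M : H < M
  H<M = subst (H <_) (cong (H +_) (sym (+-identityʳ H))) (m<m+n H (>-nonZero⁻¹ H))

  1<M : 1 < M
  1<M = ≤-<-trans (>-nonZero⁻¹ H) H<M

  2∣M : 2 ∣ M
  2∣M = m∣m*n H

  half-translation-inHol : InHol M (1 , H)
  half-translation-inHol = 1<M , H<M , Coprimality.1-coprimeTo M

  half-translation-involution : Involution M (1 , H)
  half-translation-involution = ≡-mod-refl , 0 , 1 , lemma H
    where
    lemma : ∀ H → 1 * H + H + 0 * (2 * H) ≡ 0 + 1 * (2 * H)
    lemma = solve-∀

  ¬conj-idₐ-half-translation : ¬ Conj M idₐ (1 , H)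
  ¬conj-idₐ-half-translation = ¬conj-idₐ (>-nonZero⁻¹ H) H<M

  ¬conj-reflections : ¬ Conj M (M ∸ 1 , 0) (M ∸ 1 , 1)
  ¬conj-reflections c = 2∤1 (conj-reflection-parity 2∣M (subst (2 ∣_) (sym suc[m∸1]≡m) 2∣M) c)

  translation-classes : ∀ {b} → b < M → (1 * b + b) ≡ 0 [mod M ] →
    Conj M (1 , b) (1 , 0) ⊎ Conj M (1 , b) (1 , H)
  translation-classes {b} b<M 2b≡0
    with ∣∧<2*⇒ (*-cancelˡ-∣ 2 (subst (M ∣_) (lemma b) (≡0-mod⇒∣ 2b≡0))) b<M
    where
    lemma : ∀ b → 1 * b + b ≡ 2 * b
    lemma = solve-∀
  ... | inj₁ b≡0 = inj₁ (subst (λ x → Conj M (1 , b) (1 , x)) b≡0 (conj-refl 1<M _))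
  ... | inj₂ b≡H = inj₂ (subst (λ x → Conj M (1 , b) (1 , x)) b≡H (conj-refl 1<M _))

  reflection-classes : ∀ b → Conj M (M ∸ 1 , b) (M ∸ 1 , 0) ⊎ Conj M (M ∸ 1 , b) (M ∸ 1 , 1)
  reflection-classes b with b % 2 | m%n<n b 2 | m≡m%n+[m/n]*n b 2
  ... | 0 | _ | b≡2[b/2] =
    inj₁ (conj-reflection 1<M suc[m∸1]≡m (b / 2) (≡⇒≡-mod (sym (trans b≡2[b/2] (*-comm (b / 2) 2)))))
  ... | 1 | _ | b≡1+2[b/2] =
    inj₂ (conj-reflection 1<M suc[m∸1]≡m (b / 2) (≡⇒≡-mod (sym (trans b≡1+2[b/2] (cong suc (*-comm (b / 2) 2))))))
  ... | suc (suc _) | s≤s (s≤s ()) | _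

classes-mod-4 : ClassReps 4 ((1 , 0) ∷ (1 , 2) ∷ (3 , 0) ∷ (3 , 1) ∷ [])
classes-mod-4 =
  (idₐ-inHol 1<M ∷ half-translation-inHol ∷ reflection-inHol refl 0<4 ∷ reflection-inHol refl 1<M ∷ []) ,
  (idₐ-involution ∷ half-translation-involution ∷
   reflection-involution refl 0 ∷ reflection-involution refl 1 ∷ []) ,
  ((¬conj-idₐ-half-translation ∷ ¬1~3 ∷ ¬1~3 ∷ []) ∷ (¬1~3 ∷ ¬1~3 ∷ []) ∷
   (¬conj-reflections ∷ []) ∷ [] ∷ []) ,
  cover
  where
  open EvenModulus 2
  0<4 : 0 < 4
  0<4 = z<s
  ¬1~3 : ∀ {b b′} → ¬ Conj 4 (1 , b) (3 , b′)
  ¬1~3 = ¬conj-linear-part 1<M ≤-refl (λ ())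
  reps : List Aff
  reps = (1 , 0) ∷ (1 , 2) ∷ (3 , 0) ∷ (3 , 1) ∷ []
  by-translation : ∀ {b} → b < 4 → (1 * b + b) ≡ 0 [mod 4 ] → Any (Conj 4 (1 , b)) reps
  by-translation b<4 2b≡0 = [ here , there ∘ here ]′ (translation-classes b<4 2b≡0)
  by-reflection : ∀ b → Any (Conj 4 (3 , b)) reps
  by-reflection b = [ there ∘ there ∘ here , there ∘ there ∘ there ∘ here ]′ (reflection-classes b)
  cover : ∀ g → InHol 4 g → Involution 4 g → Any (Conj 4 g) reps
  cover (a , b) (a<4 , b<4 , _) (a²≡1 , fixed) = by-root (sqrt1-mod-2^ 0 a<4 a²≡1) b<4 fixed
    where
    by-root : ∀ {a b} → Sqrt1-mod-2^ 0 a → b < 4 → (a * b + b) ≡ 0 [mod 4 ] → Any (Conj 4 (a , b)) reps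
    by-root (inj₁ refl)               b<4 fixed = by-translation b<4 fixed
    by-root (inj₂ (inj₁ refl))        _   _     = by-reflection _
    by-root (inj₂ (inj₂ (inj₁ refl))) b<4 fixed = by-translation b<4 fixed
    by-root (inj₂ (inj₂ (inj₂ refl))) _   _     = by-reflection _

module PowerOfTwoModulus (n : ℕ) where

  X Q H : ℕ
  X = 2 ^ n
  Q = 2 * X
  H = 2 * Q

  instance
    X≢0 : NonZero X
    X≢0 = m^n≢0 2 n
    Q≢0 : NonZero Q
    Q≢0 = m*n≢0 2 X
    H≢0 : NonZero H
    H≢0 = m*n≢0 2 Q

  open EvenModulus H public

  reps : List Aff
  reps = (1 , 0) ∷ (1 , H) ∷ (M ∸ 1 , 0) ∷ (M ∸ 1 , 1) ∷ (H ∸ 1 , 0) ∷ (H + 1 , 0) ∷ []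

  [H+1]²≡1 : ((H + 1) * (H + 1)) ≡ 1 [mod M ]
  [H+1]²≡1 = 0 , Q + 1 , lemma X
    where
    lemma : ∀ X → (2 * (2 * X) + 1) * (2 * (2 * X) + 1) + 0 * (2 * (2 * (2 * X)))
                  ≡ 1 + (2 * X + 1) * (2 * (2 * (2 * X)))
    lemma = solve-∀

  [H∸1]²≡1 : ((H ∸ 1) * (H ∸ 1)) ≡ 1 [mod M ]
  [H∸1]²≡1 = 1 , Q , (begin
    h * h + 1 * M          ≡⟨ cong (λ x → h * h + 1 * (2 * x)) suc[m∸1]≡m ⟨
    h * h + 1 * (2 * suc h) ≡⟨ lemma h ⟩
    1 + suc h * suc h      ≡⟨ cong (λ x → 1 + x * x) suc[m∸1]≡m ⟩
    1 + H * H              ≡⟨ lemma′ X ⟩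
    1 + Q * M              ∎)
    where
    open ≡-Reasoning
    h : ℕ
    h = H ∸ 1
    lemma : ∀ h → h * h + 1 * (2 * suc h) ≡ 1 + suc h * suc h
    lemma = solve-∀
    lemma′ : ∀ X → 1 + 2 * (2 * X) * (2 * (2 * X)) ≡ 1 + 2 * X * (2 * (2 * (2 * X)))
    lemma′ = solve-∀

  -- An involution λ(H + 1, b) has H ∣ b (Q + 1) with Q + 1 odd, so b ∈ {0, H}.
  H+1-class : ∀ {b} → b < M → ((H + 1) * b + b) ≡ 0 [mod M ] → Conj M (H + 1 , b) (H + 1 , 0)
  H+1-class {b} b<M fixed =
    [ (λ b≡0 → subst (λ x → Conj M (H + 1 , x) (H + 1 , 0)) (sym b≡0) (conj-refl 1<M _))
    , (λ b≡H → subst (λ x → Conj M (H + 1 , x) (H + 1 , 0)) (sym b≡H)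
                 (conj-by-translation 1<M 1 (1 , 0 , lemma′ X)))
    ]′ (∣∧<2*⇒ (prime^-∣-*⇒∣ prime[2] (2 + n) H∣b[Q+1] 2∤Q+1) b<M)
    where
    lemma : ∀ X b → (2 * (2 * X) + 1) * b + b ≡ 2 * (b * (2 * X + 1))
    lemma = solve-∀
    lemma′ : ∀ X → 0 + 1 + 1 * (2 * (2 * (2 * X))) ≡ 2 * (2 * X) + (2 * (2 * X) + 1) * 1 + 0 * (2 * (2 * (2 * X)))
    lemma′ = solve-∀
    H∣b[Q+1] : H ∣ b * (Q + 1)
    H∣b[Q+1] = *-cancelˡ-∣ 2 (subst (M ∣_) (lemma X b) (≡0-mod⇒∣ fixed))
    2∤Q+1 : ¬ 2 ∣ Q + 1
    2∤Q+1 2∣Q+1 = 2∤1 (∣m+n∣m⇒∣n 2∣Q+1 (m∣m*n X))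

  -- An involution λ(H − 1, b) has 2 ∣ b; conjugating by the translation by (Q + 1) b / 2
  -- removes b since (H − 2)(Q + 1) ≡ −2 modulo M.
  H∸1-class : ∀ {b} → ((H ∸ 1) * b + b) ≡ 0 [mod M ] → Conj M (H ∸ 1 , b) (H ∸ 1 , 0)
  H∸1-class {b} fixed = translate (*-cancelˡ-∣ H (subst₂ _∣_ (*-comm 2 H) Hb≡[H∸1]b+b (≡0-mod⇒∣ fixed)))
    where
    h : ℕ
    h = H ∸ 1
    Hb≡[H∸1]b+b : h * b + b ≡ H * b
    Hb≡[H∸1]b+b = trans (lemma h b) (cong (_* b) suc[m∸1]≡m)
      where
      lemma : ∀ h b → h * b + b ≡ suc h * b
      lemma = solve-∀
    translate : ∀ {b} → 2 ∣ b → Conj M (h , b) (h , 0)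
    translate (divides t refl) = conj-by-translation 1<M d (≡-mod-sym (+-cancelʳ-mod d (begin
      t * 2 + h * d + d   ≡⟨ lemma t h d ⟩
      t * 2 + suc h * d   ≡⟨ cong (λ x → t * 2 + x * d) suc[m∸1]≡m ⟩
      t * 2 + H * d       ≡⟨ lemma′ X t ⟩
      d + d + X * t * M   ≈⟨ +-congˡ-mod (d + d) (*-modulus≡0 (X * t)) ⟩
      d + d + 0           ≡⟨ lemma″ d ⟩
      0 + d + d           ∎)))
      where
      open ≡-mod-Reasoning M
      d : ℕ
      d = (Q + 1) * t
      lemma : ∀ t h d → t * 2 + h * d + d ≡ t * 2 + suc h * d
      lemma = solve-∀
      lemma′ : ∀ X t → t * 2 + 2 * (2 * X) * ((2 * X + 1) * t)
                       ≡ (2 * X + 1) * t + (2 * X + 1) * t + X * t * (2 * (2 * (2 * X)))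
      lemma′ = solve-∀
      lemma″ : ∀ d → d + d + 0 ≡ 0 + d + d
      lemma″ = solve-∀

  4≤H : 4 ≤ H
  4≤H = *-monoʳ-≤ 2 (*-monoʳ-≤ 2 (>-nonZero⁻¹ X))

  1<H∸1 : 1 < H ∸ 1
  1<H∸1 = s≤s⁻¹ (subst (2 <_) (sym suc[m∸1]≡m) (<-trans (n<1+n 2) 4≤H))

  H∸1<H+1 : H ∸ 1 < H + 1
  H∸1<H+1 = subst (_≤ H + 1) (sym suc[m∸1]≡m) (m≤m+n H 1)

  H+1<M∸1 : H + 1 < M ∸ 1
  H+1<M∸1 = s≤s⁻¹ (subst₂ _<_ (+-suc H 1) (trans (cong (H +_) (sym (+-identityʳ H))) (sym suc[m∸1]≡m))
                      (+-monoʳ-< H (<-trans (n<1+n 2) 4≤H)))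

  H+1<M : H + 1 < M
  H+1<M = <-trans H+1<M∸1 m∸1<m

  H∸1<M : H ∸ 1 < M
  H∸1<M = <-trans H∸1<H+1 H+1<M

  distinct : AllPairs (λ g h → ¬ Conj M g h) reps
  distinct =
    (¬conj-idₐ-half-translation ∷
     ≁ 1<M∸1 m∸1<m ∷ ≁ 1<M∸1 m∸1<m ∷ ≁ 1<H∸1 H∸1<M ∷ ≁ 1<H+1 H+1<M ∷ []) ∷
    (≁ 1<M∸1 m∸1<m ∷ ≁ 1<M∸1 m∸1<m ∷ ≁ 1<H∸1 H∸1<M ∷ ≁ 1<H+1 H+1<M ∷ []) ∷
    (¬conj-reflections ∷ ≁′ H∸1<M∸1 m∸1<m ∷ ≁′ H+1<M∸1 m∸1<m ∷ []) ∷
    (≁′ H∸1<M∸1 m∸1<m ∷ ≁′ H+1<M∸1 m∸1<m ∷ []) ∷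
    (≁ H∸1<H+1 H+1<M ∷ []) ∷
    [] ∷ []
    where
    ≁ : ∀ {a a′ b b′} → a < a′ → a′ < M → ¬ Conj M (a , b) (a′ , b′)
    ≁ a<a′ a′<M = ¬conj-linear-part (<-trans a<a′ a′<M) a′<M (<⇒≢ a<a′)
    ≁′ : ∀ {a a′ b b′} → a′ < a → a < M → ¬ Conj M (a , b) (a′ , b′)
    ≁′ a′<a a<M = ¬conj-linear-part a<M (<-trans a′<a a<M) (≢-sym (<⇒≢ a′<a))
    1<H+1 : 1 < H + 1
    1<H+1 = <-trans 1<H∸1 H∸1<H+1
    1<M∸1 : 1 < M ∸ 1
    1<M∸1 = <-trans 1<H+1 H+1<M∸1
    H∸1<M∸1 : H ∸ 1 < M ∸ 1
    H∸1<M∸1 = <-trans H∸1<H+1 H+1<M∸1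

  cover : ∀ g → InHol M g → Involution M g → Any (Conj M g) reps
  cover (a , b) (a<M , b<M , _) (a²≡1 , fixed) = by-root (sqrt1-mod-2^ (1 + n) a<M a²≡1) b<M fixed
    where
    by-root : ∀ {a b} → Sqrt1-mod-2^ (1 + n) a → b < M → (a * b + b) ≡ 0 [mod M ] → Any (Conj M (a , b)) reps
    by-root (inj₁ refl) b<M fixed = [ here , there ∘ here ]′ (translation-classes b<M fixed)
    by-root (inj₂ (inj₁ refl)) b<M fixed = there (there (there (there (there (here (H+1-class b<M fixed))))))
    by-root (inj₂ (inj₂ (inj₁ 1+a≡H))) _ fixed with refl ← cong (_∸ 1) 1+a≡H =
      there (there (there (there (here (H∸1-class fixed)))))
    by-root {b = b} (inj₂ (inj₂ (inj₂ 1+a≡M))) _ _ with refl ← cong (_∸ 1) 1+a≡M =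
      [ there ∘ there ∘ here , there ∘ there ∘ there ∘ here ]′ (reflection-classes b)

  classes : ClassReps M reps
  classes =
    (idₐ-inHol 1<M ∷ half-translation-inHol ∷ reflection-inHol suc[m∸1]≡m (≤-<-trans z≤n 1<M) ∷
     reflection-inHol suc[m∸1]≡m 1<M ∷ linear-inHol H∸1<M [H∸1]²≡1 ∷ linear-inHol H+1<M [H+1]²≡1 ∷ []) ,
    (idₐ-involution ∷ half-translation-involution ∷ reflection-involution suc[m∸1]≡m 0 ∷
     reflection-involution suc[m∸1]≡m 1 ∷
     linear-involution (H ∸ 1) [H∸1]²≡1 ∷ linear-involution (H + 1) [H+1]²≡1 ∷ []) ,
    distinct ,
    cover

classes-mod-2^ : ∀ k → 3 ≤ k →
  ClassReps (2 ^ k)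
    ((1 , 0) ∷ (1 , 2 ^ (k ∸ 1)) ∷ (2 ^ k ∸ 1 , 0) ∷ (2 ^ k ∸ 1 , 1)
      ∷ (2 ^ (k ∸ 1) ∸ 1 , 0) ∷ (2 ^ (k ∸ 1) + 1 , 0) ∷ [])
classes-mod-2^ 1 (s≤s ())
classes-mod-2^ 2 (s≤s (s≤s ()))
classes-mod-2^ (suc (suc (suc n))) _ = PowerOfTwoModulus.classes n

numInvClasses-2^ : ∀ ν → NumInvClasses (2 ^ ν) (c ν)
numInvClasses-2^ 0                   = _ , refl , classes-mod-1
numInvClasses-2^ 1                   = _ , refl , classes-mod-2
numInvClasses-2^ 2                   = _ , refl , classes-mod-4
numInvClasses-2^ (suc (suc (suc ν))) = _ , refl , classes-mod-2^ (3 + ν) (s≤s (s≤s (s≤s z≤n)))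

-- The Chinese remainder theorem

length-cartesianProductWith : ∀ {A B C : Set} (f : A → B → C) xs ys →
  length (cartesianProductWith f xs ys) ≡ length xs * length ys
length-cartesianProductWith f []       ys = refl
length-cartesianProductWith f (x ∷ xs) ys = begin
  length (map (f x) ys ++ cartesianProductWith f xs ys)
    ≡⟨ length-++ (map (f x) ys) ⟩
  length (map (f x) ys) + length (cartesianProductWith f xs ys)
    ≡⟨ cong₂ _+_ (length-map (f x) ys) (length-cartesianProductWith f xs ys) ⟩
  length ys + length xs * length ys
    ∎
  where open ≡-Reasoning

allPairs-cartesianProductWith⁺ : ∀ {A B C : Set} {R : C → C → Set} {S : A → A → Set} {T : B → B → Set}
  (f : A → B → C) → (∀ {x x′ y y′} → S x x′ → R (f x y) (f x′ y′)) →
  (∀ {x y y′} → T y y′ → R (f x y) (f x y′)) →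
  ∀ {xs ys} → AllPairs S xs → AllPairs T ys → AllPairs R (cartesianProductWith f xs ys)
allPairs-cartesianProductWith⁺ f S⇒R T⇒R []         _   = []
allPairs-cartesianProductWith⁺ f S⇒R T⇒R {x ∷ xs} {ys} (Sx ∷ Sxs) Tys =
  AllPairs.++⁺ (AllPairs.map⁺ (AllPairs.map T⇒R Tys)) (allPairs-cartesianProductWith⁺ f S⇒R T⇒R Sxs Tys)
    (All.map⁺ (All.universal (λ _ → All.cartesianProductWith⁺ (setoid _) (setoid _) f xs ys
                                      (λ x′∈xs _ → S⇒R (All.lookup Sx x′∈xs))) ys))

reduce : (d : ℕ) .{{_ : NonZero d}} → Aff → Aff
reduce d (a , b) = a % d , b % d

reduce-≈ : ∀ d .{{_ : NonZero d}} g → reduce d g ≈ g [in d ]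
reduce-≈ d (a , b) = %-≡-mod d a , %-≡-mod d b

inHol-reduce : ∀ {m} d .{{_ : NonZero d}} → d ∣ m → ∀ {g} → InHol m g → InHol d (reduce d g)
inHol-reduce d d∣m {a , b} (_ , _ , a⊥m) =
  m%n<n a d , m%n<n b d , coprime-resp-≡-mod (≡-mod-sym (%-≡-mod d a)) (coprime-∣ d∣m a⊥m)

involution-reduce : ∀ {m} d .{{_ : NonZero d}} → d ∣ m → ∀ {g} → Involution m g → Involution d (reduce d g)
involution-reduce d d∣m {g} g²≈id =
  ≈ₐ-trans (∘ₐ-cong (reduce-≈ d g) (reduce-≈ d g)) (≈ₐ-∣ d∣m g²≈id)

conj-reduce : ∀ {m} d .{{_ : NonZero d}} → d ∣ m → ∀ {g h g′ h′} → Conj m g h →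
  g ≈ g′ [in d ] → h ≈ h′ [in d ] → Conj d g′ h′
conj-reduce d d∣m (u , v , u∈Hol , v∈Hol , uv≈id , ugv≈h) g≈g′ h≈h′ =
  reduce d u , reduce d v , inHol-reduce d d∣m u∈Hol , inHol-reduce d d∣m v∈Hol ,
  ≈ₐ-trans (∘ₐ-cong (reduce-≈ d u) (reduce-≈ d v)) (≈ₐ-∣ d∣m uv≈id) ,
  ≈ₐ-trans (∘ₐ-cong (∘ₐ-cong (reduce-≈ d u) (≈ₐ-sym g≈g′)) (reduce-≈ d v))
           (≈ₐ-trans (≈ₐ-∣ d∣m ugv≈h) h≈h′)

module ChineseRemainder (q r : ℕ) .{{_ : NonZero q}} .{{_ : NonZero r}} (q⊥r : Coprime q r) where

  instance
    qr≢0 : NonZero (q * r)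
    qr≢0 = m*n≢0 q r

  q∣qr : q ∣ q * r
  q∣qr = m∣m*n r

  r∣qr : r ∣ q * r
  r∣qr = n∣m*n q

  idq idr : ℕ
  idq = r * proj₁ (coprime⇒invertible (Coprimality.sym q⊥r))
  idr = q * proj₁ (coprime⇒invertible q⊥r)

  idq≡1 : idq ≡ 1 [mod q ]
  idq≡1 = proj₂ (coprime⇒invertible (Coprimality.sym q⊥r))

  idr≡1 : idr ≡ 1 [mod r ]
  idr≡1 = proj₂ (coprime⇒invertible q⊥r)

  idq≡0 : idq ≡ 0 [mod r ]
  idq≡0 = ∣⇒≡0-mod (m∣m*n _)

  idr≡0 : idr ≡ 0 [mod q ]
  idr≡0 = ∣⇒≡0-mod (m∣m*n _)

  crt : ℕ → ℕ → ℕ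
  crt x y = (x * idq + y * idr) % (q * r)

  crt-≡ˡ : ∀ x y → crt x y ≡ x [mod q ]
  crt-≡ˡ x y = begin
    crt x y           ≈⟨ ≡-mod-∣ q∣qr (%-≡-mod (q * r) _) ⟩
    x * idq + y * idr ≈⟨ +-cong-mod (*-congˡ-mod x idq≡1) (*-congˡ-mod y idr≡0) ⟩
    x * 1 + y * 0     ≡⟨ cong₂ _+_ (*-identityʳ x) (*-zeroʳ y) ⟩
    x + 0             ≡⟨ +-identityʳ x ⟩
    x                 ∎
    where open ≡-mod-Reasoning q

  crt-≡ʳ : ∀ x y → crt x y ≡ y [mod r ]
  crt-≡ʳ x y = begin
    crt x y           ≈⟨ ≡-mod-∣ r∣qr (%-≡-mod (q * r) _) ⟩
    x * idq + y * idr ≈⟨ +-cong-mod (*-congˡ-mod x idq≡0) (*-congˡ-mod y idr≡1) ⟩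
    x * 0 + y * 1     ≡⟨ cong₂ _+_ (*-zeroʳ x) (*-identityʳ y) ⟩
    y                 ∎
    where open ≡-mod-Reasoning r

  crtₐ : Aff → Aff → Aff
  crtₐ (a₁ , b₁) (a₂ , b₂) = crt a₁ a₂ , crt b₁ b₂

  crtₐ-≈ˡ : ∀ g₁ g₂ → crtₐ g₁ g₂ ≈ g₁ [in q ]
  crtₐ-≈ˡ (a₁ , b₁) (a₂ , b₂) = crt-≡ˡ a₁ a₂ , crt-≡ˡ b₁ b₂

  crtₐ-≈ʳ : ∀ g₁ g₂ → crtₐ g₁ g₂ ≈ g₂ [in r ]
  crtₐ-≈ʳ (a₁ , b₁) (a₂ , b₂) = crt-≡ʳ a₁ a₂ , crt-≡ʳ b₁ b₂

  ≈ₐ-* : ∀ {g h} → g ≈ h [in q ] → g ≈ h [in r ] → g ≈ h [in (q * r) ]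
  ≈ₐ-* (e , f) (e′ , f′) = ≡-mod-* q⊥r e e′ , ≡-mod-* q⊥r f f′

  coprime-crt : ∀ {a₁ a₂} → Coprime a₁ q → Coprime a₂ r → Coprime (crt a₁ a₂) (q * r)
  coprime-crt {a₁} {a₂} a₁⊥q a₂⊥r with coprime⇒invertible a₁⊥q | coprime⇒invertible a₂⊥r
  ... | x₁ , a₁x₁≡1 | x₂ , a₂x₂≡1 = invertible⇒coprime {x = crt x₁ x₂} (≡-mod-* q⊥r
    (≡-mod-trans (*-cong-mod (crt-≡ˡ a₁ a₂) (crt-≡ˡ x₁ x₂)) a₁x₁≡1)
    (≡-mod-trans (*-cong-mod (crt-≡ʳ a₁ a₂) (crt-≡ʳ x₁ x₂)) a₂x₂≡1))

  inHol-crtₐ : ∀ {g₁ g₂} → InHol q g₁ → InHol r g₂ → InHol (q * r) (crtₐ g₁ g₂)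
  inHol-crtₐ (_ , _ , a₁⊥q) (_ , _ , a₂⊥r) = m%n<n _ (q * r) , m%n<n _ (q * r) , coprime-crt a₁⊥q a₂⊥r

  involution-crtₐ : ∀ {g₁ g₂} → Involution q g₁ → Involution r g₂ → Involution (q * r) (crtₐ g₁ g₂)
  involution-crtₐ {g₁} {g₂} g₁²≈id g₂²≈id =
    ≈ₐ-* (≈ₐ-trans (∘ₐ-cong (crtₐ-≈ˡ g₁ g₂) (crtₐ-≈ˡ g₁ g₂)) g₁²≈id)
         (≈ₐ-trans (∘ₐ-cong (crtₐ-≈ʳ g₁ g₂) (crtₐ-≈ʳ g₁ g₂)) g₂²≈id)

  conj-crtₐ : ∀ {g g₁ g₂ h₁ h₂} → g ≈ g₁ [in q ] → g ≈ g₂ [in r ] →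
    Conj q g₁ h₁ → Conj r g₂ h₂ → Conj (q * r) g (crtₐ h₁ h₂)
  conj-crtₐ {g} {g₁} {g₂} {h₁} {h₂} g≈g₁ g≈g₂
    (u₁ , v₁ , u₁∈Hol , v₁∈Hol , u₁v₁≈id , u₁g₁v₁≈h₁)
    (u₂ , v₂ , u₂∈Hol , v₂∈Hol , u₂v₂≈id , u₂g₂v₂≈h₂) =
    crtₐ u₁ u₂ , crtₐ v₁ v₂ , inHol-crtₐ u₁∈Hol u₂∈Hol , inHol-crtₐ v₁∈Hol v₂∈Hol ,
    ≈ₐ-* (≈ₐ-trans (∘ₐ-cong (crtₐ-≈ˡ u₁ u₂) (crtₐ-≈ˡ v₁ v₂)) u₁v₁≈id)
         (≈ₐ-trans (∘ₐ-cong (crtₐ-≈ʳ u₁ u₂) (crtₐ-≈ʳ v₁ v₂)) u₂v₂≈id) ,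
    ≈ₐ-* (≈ₐ-trans (∘ₐ-cong (∘ₐ-cong (crtₐ-≈ˡ u₁ u₂) g≈g₁) (crtₐ-≈ˡ v₁ v₂))
                   (≈ₐ-trans u₁g₁v₁≈h₁ (≈ₐ-sym (crtₐ-≈ˡ h₁ h₂))))
         (≈ₐ-trans (∘ₐ-cong (∘ₐ-cong (crtₐ-≈ʳ u₁ u₂) g≈g₂) (crtₐ-≈ʳ v₁ v₂))
                   (≈ₐ-trans u₂g₂v₂≈h₂ (≈ₐ-sym (crtₐ-≈ʳ h₁ h₂))))

  numInvClasses-* : ∀ {N₁ N₂} → NumInvClasses q N₁ → NumInvClasses r N₂ → NumInvClasses (q * r) (N₁ * N₂)
  numInvClasses-* (L₁ , refl , inHol₁ , inv₁ , distinct₁ , cover₁)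
                  (L₂ , refl , inHol₂ , inv₂ , distinct₂ , cover₂) =
    cartesianProductWith crtₐ L₁ L₂ ,
    length-cartesianProductWith crtₐ L₁ L₂ ,
    All.cartesianProductWith⁺ (setoid _) (setoid _) crtₐ L₁ L₂
      (λ {g₁} {g₂} g₁∈L₁ g₂∈L₂ →
         inHol-crtₐ {g₁} {g₂} (All.lookup inHol₁ g₁∈L₁) (All.lookup inHol₂ g₂∈L₂)) ,
    All.cartesianProductWith⁺ (setoid _) (setoid _) crtₐ L₁ L₂
      (λ {g₁} {g₂} g₁∈L₁ g₂∈L₂ →
         involution-crtₐ {g₁} {g₂} (All.lookup inv₁ g₁∈L₁) (All.lookup inv₂ g₂∈L₂)) ,
    allPairs-cartesianProductWith⁺ crtₐ
      (λ {g₁} {g₁′} {g₂} {g₂′} ≁ c → ≁ (conj-reduce q q∣qr c (crtₐ-≈ˡ g₁ g₂) (crtₐ-≈ˡ g₁′ g₂′)))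
      (λ {g₁} {g₂} {g₂′} ≁ c → ≁ (conj-reduce r r∣qr c (crtₐ-≈ʳ g₁ g₂) (crtₐ-≈ʳ g₁ g₂′)))
      distinct₁ distinct₂ ,
    λ g g∈Hol g²≈id → Any.cartesianProductWith⁺ crtₐ
      (conj-crtₐ (≈ₐ-sym (reduce-≈ q g)) (≈ₐ-sym (reduce-≈ r g)))
      (cover₁ (reduce q g) (inHol-reduce q q∣qr g∈Hol) (involution-reduce q q∣qr g²≈id))
      (cover₂ (reduce r g) (inHol-reduce r r∣qr g∈Hol) (involution-reduce r r∣qr g²≈id))

-- Counting odd prime divisors

countBelow : ∀ {P : ℕ → Set} → (∀ x → Dec (P x)) → ℕ → ℕ
countBelow P? zero    = 0
countBelow P? (suc n) = countBelow P? n + (if does (P? n) then 1 else 0)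

length-filter-upTo : ∀ {P : ℕ → Set} (P? : ∀ x → Dec (P x)) n →
  length (filter P? (upTo n)) ≡ countBelow P? n
length-filter-upTo P? zero    = refl
length-filter-upTo P? (suc n) = begin
  length (filter P? (upTo (suc n)))                      ≡⟨ cong (length ∘ filter P?) (upTo-∷ʳ n) ⟨
  length (filter P? (upTo n ++ n ∷ []))                  ≡⟨ cong length (filter-++ P? (upTo n) (n ∷ [])) ⟩
  length (filter P? (upTo n) ++ filter P? (n ∷ []))      ≡⟨ length-++ (filter P? (upTo n)) ⟩
  length (filter P? (upTo n)) + length (filter P? (n ∷ [])) ≡⟨ cong₂ _+_ (length-filter-upTo P? n) singleton ⟩
  countBelow P? (suc n)                                  ∎
  where
  open ≡-Reasoning
  singleton : length (filter P? (n ∷ [])) ≡ (if does (P? n) then 1 else 0)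
  singleton with does (P? n)
  ... | true  = refl
  ... | false = refl

countBelow-none : ∀ {P : ℕ → Set} (P? : ∀ x → Dec (P x)) n → (∀ x → x < n → ¬ P x) →
  countBelow P? n ≡ 0
countBelow-none P? zero    _  = refl
countBelow-none P? (suc n) ¬P = cong₂ _+_ (countBelow-none P? n (λ x x<n → ¬P x (m<n⇒m<1+n x<n)))
                                          (cong (λ b → if b then 1 else 0) (dec-false (P? n) (¬P n ≤-refl)))

countBelow-cong : ∀ {P Q : ℕ → Set} (P? : ∀ x → Dec (P x)) (Q? : ∀ x → Dec (Q x)) n →
  (∀ x → x < n → P x ⇔ Q x) → countBelow P? n ≡ countBelow Q? n
countBelow-cong P? Q? zero    _   = refl
countBelow-cong P? Q? (suc n) P⇔Q = cong₂ _+_ (countBelow-cong P? Q? n (λ x x<n → P⇔Q x (m<n⇒m<1+n x<n)))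
                                              (cong (λ b → if b then 1 else 0) (does-⇔ (P⇔Q n ≤-refl) (P? n) (Q? n)))

countBelow-drop : ∀ {P Q : ℕ → Set} (P? : ∀ x → Dec (P x)) (Q? : ∀ x → Dec (Q x)) {q} n → q < n →
  P q → ¬ Q q → (∀ x → x ≢ q → P x ⇔ Q x) → countBelow P? n ≡ suc (countBelow Q? n)
countBelow-drop P? Q? {q} (suc n) q<1+n Pq ¬Qq P⇔Q with m≤n⇒m<n∨m≡n (s≤s⁻¹ q<1+n)
... | inj₁ q<n = cong₂ _+_ (countBelow-drop P? Q? n q<n Pq ¬Qq P⇔Q)
                           (cong (λ b → if b then 1 else 0) (does-⇔ (P⇔Q n (≢-sym (<⇒≢ q<n))) (P? n) (Q? n)))
... | inj₂ refl rewrite dec-true (P? q) Pq | dec-false (Q? q) ¬Qq =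
  trans (+-comm (countBelow P? q) 1) (cong suc (trans below (sym (+-identityʳ _))))
  where
  below : countBelow P? q ≡ countBelow Q? q
  below = countBelow-cong P? Q? q (λ x x<q → P⇔Q x (<⇒≢ x<q))

OddPrimeDivisor : ℕ → ℕ → Set
OddPrimeDivisor m p = 2 < p × Prime p × p ∣ m

oddPrimeDivisor? : ∀ m p → Dec (OddPrimeDivisor m p)
oddPrimeDivisor? m p = (2 <? p) ×-dec (prime? p ×-dec (p ∣? m))

no-odd-prime-divisor⇒≡2^ : ∀ {m ν} → .{{_ : NonZero m}} → 2 ^ ν ∣ m → ¬ 2 ^ suc ν ∣ m →
  (∀ {q} → ¬ OddPrimeDivisor m q) → m ≡ 2 ^ ν
no-odd-prime-divisor⇒≡2^ {m} {ν} (divides zero m≡0) _ _ = ⊥-elim (≢-nonZero⁻¹ m m≡0)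
no-odd-prime-divisor⇒≡2^ {m} {ν} (divides 1 m≡2ᵛ) _ _ = trans m≡2ᵛ (+-identityʳ (2 ^ ν))
no-odd-prime-divisor⇒≡2^ {m} {ν} (divides s@(suc (suc _)) m≡s2ᵛ) 2ᵛ⁺¹∤m ∄q
  with ∃-prime-divisor s (s≤s (s≤s z≤n))
... | q , pq , q∣s = ⊥-elim (∄q (≤∧≢⇒< (nonTrivial⇒n>1 q {{prime⇒nonTrivial pq}}) 2≢q , pq , q∣m))
  where
  s∣m : s ∣ m
  s∣m = divides (2 ^ ν) (trans m≡s2ᵛ (*-comm s (2 ^ ν)))
  q∣m : q ∣ m
  q∣m = ∣-trans q∣s s∣m
  2≢q : 2 ≢ q
  2≢q refl = 2ᵛ⁺¹∤m (subst (2 ^ suc ν ∣_) (sym m≡s2ᵛ) (*-monoˡ-∣ (2 ^ ν) q∣s))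

oddPrimeDivisors-prime^-* : ∀ {q r} j N → Prime q → 2 < q → ¬ q ∣ r → q < N →
  countBelow (oddPrimeDivisor? (q ^ suc j * r)) N ≡ suc (countBelow (oddPrimeDivisor? r) N)
oddPrimeDivisors-prime^-* {q} {r} j N pq 2<q q∤r q<N =
  countBelow-drop (oddPrimeDivisor? (Q * r)) (oddPrimeDivisor? r) N q<N
    (2<q , pq , ∣m⇒∣m*n r (m∣m*n (q ^ j))) (λ (_ , _ , q∣r) → q∤r q∣r) same-divisors
  where
  Q : ℕ
  Q = q ^ suc j
  same-divisors : ∀ x → x ≢ q → OddPrimeDivisor (Q * r) x ⇔ OddPrimeDivisor r x
  same-divisors x x≢q = mk⇔ to (λ (2<x , px , x∣r) → 2<x , px , ∣n⇒∣m*n Q x∣r)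
    where
    to : OddPrimeDivisor (Q * r) x → OddPrimeDivisor r x
    to (2<x , px , x∣Qr) with euclidsLemma Q r px x∣Qr
    ... | inj₁ x∣Q = ⊥-elim (x≢q (prime∣prime^⇒≡ px pq (suc j) x∣Q))
    ... | inj₂ x∣r = 2<x , px , x∣r

-- The odd prime divisors of m are counted below an arbitrary bound N > m, so that the
-- same bound serves for the cofactor r of m in the induction.
numInvClasses-below : ∀ ν m → .{{_ : NonZero m}} → 2 ^ ν ∣ m → ¬ 2 ^ suc ν ∣ m → ∀ N → m < N →
  NumInvClasses m (c ν * 2 ^ countBelow (oddPrimeDivisor? m) N)
numInvClasses-below ν = <-rec Claim step
  where
  Claim : ℕ → Set
  Claim m = .{{_ : NonZero m}} → 2 ^ ν ∣ m → ¬ 2 ^ suc ν ∣ m → ∀ N → m < N →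
    NumInvClasses m (c ν * 2 ^ countBelow (oddPrimeDivisor? m) N)
  step : ∀ m → (∀ {r} → r < m → Claim r) → Claim m
  step m rec 2ᵛ∣m 2ᵛ⁺¹∤m N m<N with anyUpTo? (oddPrimeDivisor? m) N
  ... | no ∄q = subst₂ NumInvClasses (sym m≡2ᵛ) (sym count≡0) (numInvClasses-2^ ν)
    where
    m≡2ᵛ : m ≡ 2 ^ ν
    m≡2ᵛ = no-odd-prime-divisor⇒≡2^ {ν = ν} 2ᵛ∣m 2ᵛ⁺¹∤m
             (λ {q} q-odd@(_ , _ , q∣m) → ∄q (q , ≤-<-trans (∣⇒≤ q∣m) m<N , q-odd))
    count≡0 : c ν * 2 ^ countBelow (oddPrimeDivisor? m) N ≡ c ν
    count≡0 = trans (cong (λ k → c ν * 2 ^ k)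
                          (countBelow-none (oddPrimeDivisor? m) N (λ q q<N q-odd → ∄q (q , q<N , q-odd))))
                    (*-identityʳ (c ν))
  ... | yes (q , q<N , (2<q , pq , q∣m)) with prime^-split pq m
  ...   | zero , r , m≡r , q∤r = ⊥-elim (q∤r (subst (q ∣_) (trans m≡r (*-identityˡ r)) q∣m))
  ...   | suc j , r , refl , q∤r =
    subst (NumInvClasses m) count≡ (ChineseRemainder.numInvClasses-* Q r Q⊥r Q-classes r-classes)
    where
    Q : ℕ
    Q = q ^ suc j
    instance
      Q≢0 : NonZero Q
      Q≢0 = m*n≢0⇒m≢0 Q
      r≢0 : NonZero r
      r≢0 = m*n≢0⇒n≢0 Q
    1<Q : 1 < Q
    1<Q = <-≤-trans (<-trans (n<1+n 1) 2<q)
                    (subst (_≤ Q) (*-identityʳ q) (^-monoʳ-≤ q {{prime⇒nonZero pq}} (s≤s (z≤n {j}))))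
    r<m : r < m
    r<m = subst (r <_) (*-comm r Q) (m<m*n r Q 1<Q)
    Q⊥r : Coprime Q r
    Q⊥r = coprime-^ (prime∤⇒coprime pq q∤r) (suc j)
    Q-classes : NumInvClasses Q 2
    Q-classes = _ , refl , odd-prime^-classes q (suc j) pq 2<q (s≤s z≤n)
    r-classes : NumInvClasses r (c ν * 2 ^ countBelow (oddPrimeDivisor? r) N)
    r-classes =
      rec r<m (prime^-∣-*⇒∣ prime[2] ν (subst (2 ^ ν ∣_) (*-comm Q r) 2ᵛ∣m) (2∤odd-prime^ pq 2<q (suc j)))
              (λ 2ᵛ⁺¹∣r → 2ᵛ⁺¹∤m (∣n⇒∣m*n Q 2ᵛ⁺¹∣r)) N (<-trans r<m m<N)
    count≡ : 2 * (c ν * 2 ^ countBelow (oddPrimeDivisor? r) N) ≡ c ν * 2 ^ countBelow (oddPrimeDivisor? m) N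
    count≡ = trans (lemma (c ν) _) (cong (λ k → c ν * 2 ^ k) (sym (oddPrimeDivisors-prime^-* j N pq 2<q q∤r q<N)))
      where
      lemma : ∀ a b → 2 * (a * b) ≡ a * (2 * b)
      lemma = solve-∀

numInvClasses : (m ν : ℕ) → 1 ≤ m → 2 ^ ν ∣ m → ¬ (2 ^ suc ν ∣ m) →
  NumInvClasses m (c ν * 2 ^ oddPrimeDivisorCount m)
numInvClasses m ν 1≤m 2ᵛ∣m 2ᵛ⁺¹∤m =
  subst (λ k → NumInvClasses m (c ν * 2 ^ k)) (sym (length-filter-upTo (oddPrimeDivisor? m) (suc m)))
    (numInvClasses-below ν m {{>-nonZero 1≤m}} 2ᵛ∣m 2ᵛ⁺¹∤m (suc m) ≤-refl)

lemma5p4 :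
    ((p k : ℕ) → Prime p → 2 < p → 1 ≤ k →
      ClassReps (p ^ k) ((1 , 0) ∷ (p ^ k ∸ 1 , 0) ∷ []))
    × ClassReps 2 ((1 , 0) ∷ (1 , 1) ∷ [])
    × ClassReps 4 ((1 , 0) ∷ (1 , 2) ∷ (3 , 0) ∷ (3 , 1) ∷ [])
    × ((k : ℕ) → 3 ≤ k →
      ClassReps (2 ^ k)
        ((1 , 0) ∷ (1 , 2 ^ (k ∸ 1)) ∷ (2 ^ k ∸ 1 , 0) ∷ (2 ^ k ∸ 1 , 1)
          ∷ (2 ^ (k ∸ 1) ∸ 1 , 0) ∷ (2 ^ (k ∸ 1) + 1 , 0) ∷ []))
    × ((m ν : ℕ) → 1 ≤ m → 2 ^ ν ∣ m → ¬ (2 ^ suc ν ∣ m) →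
      NumInvClasses m (c ν * 2 ^ oddPrimeDivisorCount m))
lemma5p4 = odd-prime^-classes , classes-mod-2 , classes-mod-4 , classes-mod-2^ , numInvClasses
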